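{- Let $q=2^h$ with $h\ge 2$, and consider $\mathrm{PG}(2,q)$ with point set $\mathcal{P}$ and line set $\mathcal{L}$. Let $\mathcal{M}$ be a maximal $(\frac{q^2}{2}-\frac{q}{2};\frac{q}{2})$-arc of $\mathrm{PG}(2,q)$, i.e. a nonempty set of $\frac{q^2}{2}-\frac{q}{2}$ points such that every line meets $\mathcal{M}$ in either $0$ or $\frac{q}{2}$ points, and let $\ell$ be a line with $|\ell\cap\mathcal{M}|=\frac{q}{2}$. Let $\mathcal{P}_1=\mathcal{M}\triangle\ell$ (the symmetric difference of $\mathcal{M}$ and the point set of $\ell$), and let $\mathcal{L}_1$ be the set of lines which pass through a point of $\ell\setminus\mathcal{M}$ and intersect $\mathcal{M}$. Then, with $A=\mathcal{P}_1\cup\mathcal{L}_1$ and $B=(\mathcal{P}\setminus\mathcal{P}_1)\cup(\mathcal{L}\setminus\mathcal{L}_1)$, the partition $A\cup B$ is an internal partition of the point-line incidence graph of $\mathrm{PG}(2,q)$.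
   Context: $\mathrm{PG}(2,q)$ is the desarguesian projective plane over $\mathbb{F}_q$ (points and lines are the 1- and 2-dimensional subspaces of $\mathbb{F}_q^3$, incidence by containment); every line has $q+1$ points and every point lies on $q+1$ lines. The point-line incidence graph is the bipartite graph on points and lines with adjacency given by incidence. For a graph $G$, $d(v)$ is the degree of $v$ and $d_U(v)$ the number of neighbours of $v$ in $U$. An internal partition of $G$ is a partition $V(G)=A\cup B$ into two nonempty sets with $d_A(v)\ge d(v)/2$ for all $v\in A$ and $d_B(v)\ge d(v)/2$ for all $v\in B$. -}

module Defs where

open import Level using (0ℓ)
open import Data.Nat using (ℕ; _≤_; _*_; _^_; _∸_)
open import Data.Fin using (Fin)
open import Data.Bool using (Bool; true; false)
open import Data.Product using (Σ; ∃; _×_; _,_)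
open import Data.Sum using (_⊎_; inj₁; inj₂)
open import Data.Empty using (⊥)
open import Relation.Nullary using (¬_)
open import Relation.Binary.PropositionalEquality using (_≡_)
open import Function.Bundles using (_↔_; _⇔_)
open import Algebra.Core using (Op₁; Op₂)
open import Algebra.Structures using (IsCommutativeRing)

HasSize : Set → ℕ → Set
HasSize A n = A ↔ Fin n

record FiniteField (q : ℕ) : Set₁ where
  infixl 7 _·_
  infixl 6 _⊕_
  field
    Carrier : Set
    _⊕_ _·_ : Op₂ Carrier
    ⊖_ : Op₁ Carrier
    0# 1# : Carrier
    isCommutativeRing : IsCommutativeRing _≡_ _⊕_ _·_ ⊖_ 0# 1#
    0≢1 : ¬ (0# ≡ 1#)
    inverse : ∀ x → ¬ (x ≡ 0#) → Σ Carrier (λ y → x · y ≡ 1#)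
    enumeration : Fin q ↔ Carrier

module PG2 {q : ℕ} (F : FiniteField q) where
  open FiniteField F

  Vec3 : Set
  Vec3 = Carrier × Carrier × Carrier

  -- normalized representative of a 1-dimensional subspace of F^3:
  -- first nonzero coordinate equals 1
  Normalized : Vec3 → Set
  Normalized (x , y , z) =
    (x ≡ 1#) ⊎ ((x ≡ 0#) × (y ≡ 1#)) ⊎ ((x ≡ 0#) × (y ≡ 0#) × (z ≡ 1#))

  Point : Set
  Point = Σ Vec3 Normalized

  -- lines of PG(2,q): 2-dim subspaces of F^3 = kernels of nonzero linear
  -- forms, given by normalized coefficient vectors (a,b,c)
  Line : Set
  Line = Σ Vec3 Normalized

  Incident : Point → Line → Set
  Incident ((x , y , z) , _) ((a , b , c) , _) = a · x ⊕ b · y ⊕ c · z ≡ 0#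

  Vertex : Set
  Vertex = Point ⊎ Line

  Adj : Vertex → Vertex → Set
  Adj (inj₁ p) (inj₁ p') = ⊥
  Adj (inj₁ p) (inj₂ L) = Incident p L
  Adj (inj₂ L) (inj₁ p) = Incident p L
  Adj (inj₂ L) (inj₂ L') = ⊥

-- Internal partition of a (finite) graph (V, Adj); the part A is given by its
-- characteristic function inA, and B is its complement.
-- d_A(v) ≥ d(v)/2 is written as d(v) ≤ 2 · d_A(v).
record IsInternalPartition (V : Set) (Adj : V → V → Set) (inA : V → Bool) : Set where
  field
    A-nonempty : Σ V (λ v → inA v ≡ true)
    B-nonempty : Σ V (λ v → inA v ≡ false)
    A-internal : ∀ v → inA v ≡ true → ∀ d dA →
      HasSize (Σ V (λ w → Adj v w)) d →
      HasSize (Σ V (λ w → Adj v w × inA w ≡ true)) dA →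
      d ≤ 2 * dA
    B-internal : ∀ v → inA v ≡ false → ∀ d dB →
      HasSize (Σ V (λ w → Adj v w)) d →
      HasSize (Σ V (λ w → Adj v w × inA w ≡ false)) dB →
      d ≤ 2 * dB

-- Write q = 2k and P₁ = M △ ℓ. Every vertex has degree q + 1 = 2k + 1, so it suffices that each
-- vertex has at least k + 1 neighbours on its own side. For p ∉ ℓ the lines through p correspond to
-- the points of ℓ, and a line N ≠ ℓ meeting ℓ in r lies in L₁ iff r ∉ M and N is a secant of M.
-- Hence a point of M ∖ ℓ lies on the k + 1 lines joining it to ℓ ∖ M, all in L₁; a point of ℓ ∖ M
-- lies on the q − 1 = |M|/k secants through it, all in L₁; a point of M ∩ ℓ lies on q lines other
-- than ℓ, none in L₁; a point off M ∪ ℓ lies on the k lines joining it to M ∩ ℓ and on the two lines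
-- through it that miss M, none in L₁. As for lines, ℓ carries the k + 1 points of ℓ ∖ M, and any
-- other line of L₁ meets ℓ in a point of ℓ ∖ M and carries k further points, those of M ∖ ℓ. A line
-- outside L₁ either misses M, leaving q of its points off ℓ, or is a secant meeting ℓ inside M, and
-- then its k + 1 points outside M all lie off ℓ.

module Submission where

open import Defs
open import Data.Nat using (ℕ; _≤_; _*_; _^_; _∸_)
open import Data.Bool using (Bool; true; false)
open import Data.Product using (Σ; _×_; _,_)
open import Data.Sum using (_⊎_; inj₁; inj₂)
open import Relation.Nullary using (¬_)
open import Relation.Binary.PropositionalEquality using (_≡_)
open import Function.Bundles using (_⇔_)

open import Algebra.Bundles using (CommutativeRing)
open import Algebra.Properties.CommutativeSemigroup using (interchange)
open import Axiom.UniquenessOfIdentityProofs using (module Decidable⇒UIP)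
open import Data.Bool using (_∧_; not; _xor_; if_then_else_)
open import Data.Bool.Properties using (∧-identityʳ; ∧-zeroʳ; ∧-assoc; ¬-not)
open import Data.Empty using (⊥; ⊥-elim)
open import Data.Fin using (Fin; fromℕ<)
import Data.Fin as Fin
open import Data.Fin.Patterns using (0F; 1F; 2F)
open import Data.Fin.Permutation using (↔⇒≡)
open import Data.Fin.Properties using (inj⇒≟; +↔⊎; *↔×; 1↔⊤; injective⇒≤; toℕ<n)
open import Data.Nat using (suc; _+_; _<_; z≤n; s≤s; _≤?_; >-nonZero)
open import Data.Nat.Properties
  using (+-commutativeSemigroup; ≤-<-trans; suc-injective; ≤-trans; ≤-reflexive; +-mono-≤;
         +-cancelˡ-≡; *-cancelʳ-≡; *-monoʳ-≤; m≤m+n; n≤1+n; m^n>0; module ≤-Reasoning)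
import Data.Nat.Properties as ℕₚ
open import Data.Nat.Tactic.RingSolver using (solve-∀)
open import Data.Product using (proj₁; proj₂)
import Data.Product as Prod
open import Data.Product.Function.Dependent.Propositional using (Σ-↔)
open import Data.Product.Function.NonDependent.Propositional using (_×-↔_)
import Data.Product.Properties as Prodₚ
open import Data.Sum using ([_,_]′)
import Data.Sum as Sum
open import Data.Sum.Function.Propositional using (_⊎-↔_)
open import Data.Unit using (⊤; tt)
open import Function using (_∘_; id; case_of_)
open import Function.Bundles using (_↔_; _↣_; Inverse; Injection; Equivalence; mk↔ₛ′; mk↣; mk⇔)
open import Function.Construct.Composition using (_↣-∘_)
open import Function.Properties.Inverse using (↔-refl; ↔-sym; ↔-trans; ↔⇒↣)
open import Level using (0ℓ)
open import Relation.Binary.Definitions using (DecidableEquality)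
open import Relation.Binary.PropositionalEquality using (refl; sym; trans; cong; cong₂; subst; subst₂; module ≡-Reasoning)
open import Relation.Nullary using (Irrelevant; Dec; yes; no; does)
open import Relation.Nullary.Decidable using (_⊎-dec_; _×-dec_; map′; does-⇔)

private variable
  A B : Set
  m n : ℕ

Bool-≡-irrelevant : {a b : Bool} → Irrelevant (a ≡ b)
Bool-≡-irrelevant = Decidable⇒UIP.≡-irrelevant Data.Bool._≟_

⇔⇒↔ : Irrelevant A → Irrelevant B → A ⇔ B → A ↔ B
⇔⇒↔ irrA irrB A⇔B = mk↔ₛ′ to from (λ _ → irrB _ _) (λ _ → irrA _ _)
  where open Equivalence A⇔B

×-irrelevant : Irrelevant A → Irrelevant B → Irrelevant (A × B)
×-irrelevant irrA irrB (a , b) (a′ , b′) = cong₂ _,_ (irrA a a′) (irrB b b′)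

⊎-irrelevant : Irrelevant A → Irrelevant B → (A → ¬ B) → Irrelevant (A ⊎ B)
⊎-irrelevant irrA irrB A⇒¬B (inj₁ a) (inj₁ a′) = cong inj₁ (irrA a a′)
⊎-irrelevant irrA irrB A⇒¬B (inj₁ a) (inj₂ b)  = ⊥-elim (A⇒¬B a b)
⊎-irrelevant irrA irrB A⇒¬B (inj₂ b) (inj₁ a)  = ⊥-elim (A⇒¬B a b)
⊎-irrelevant irrA irrB A⇒¬B (inj₂ b) (inj₂ b′) = cong inj₂ (irrB b b′)

does⇔ : (a? : Dec A) → A ⇔ (does a? ≡ true)
does⇔ (yes a) = mk⇔ (λ _ → refl) (λ _ → a)
does⇔ (no ¬a) = mk⇔ (λ a → ⊥-elim (¬a a)) (λ ())

∧-elimˡ : ∀ {a b} → a ∧ b ≡ true → a ≡ true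
∧-elimˡ {true} _ = refl

∧-elimʳ : ∀ {a b} → a ∧ b ≡ true → b ≡ true
∧-elimʳ {true} e = e

∧-intro : ∀ {a b} → a ≡ true → b ≡ true → a ∧ b ≡ true
∧-intro refl e = e

≢-by : ∀ {X : Set} (f : X → Bool) {x y} → f x ≡ true → f y ≡ false → ¬ x ≡ y
≢-by f fx≡true fy≡false refl with () ← trans (sym fx≡true) fy≡false

×⇔∧ : ∀ {a b} → A ⇔ (a ≡ true) → B ⇔ (b ≡ true) → (A × B) ⇔ (a ∧ b ≡ true)
×⇔∧ A⇔a B⇔b = mk⇔ (λ (x , y) → ∧-intro (to A⇔a x) (to B⇔b y))
                  (λ e → from A⇔a (∧-elimˡ e) , from B⇔b (∧-elimʳ e))
  where open Equivalence

⇔⇒≡ : ∀ {a b} → (a ≡ true) ⇔ (b ≡ true) → a ≡ b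
⇔⇒≡ {true}  {true}  _   = refl
⇔⇒≡ {false} {false} _   = refl
⇔⇒≡ {true}  {false} a⇔b = sym (Equivalence.to a⇔b refl)
⇔⇒≡ {false} {true}  a⇔b = Equivalence.from a⇔b refl

not-≡true : ∀ {b} → not b ≡ true → b ≡ false
not-≡true {false} _ = refl

not-≡false : ∀ {b} → not b ≡ false → b ≡ true
not-≡false {true} _ = refl

xor-intro : ∀ {a m i} →
  (a ≡ true → (m ≡ true × i ≡ false) ⊎ (m ≡ false × i ≡ true)) →
  ((m ≡ true × i ≡ false) ⊎ (m ≡ false × i ≡ true) → a ≡ true) → a ≡ m xor i
xor-intro {true}  a⇒ _ with a⇒ refl
... | inj₁ (refl , refl) = refl
... | inj₂ (refl , refl) = refl
xor-intro {false} {true}  {true}  _ _ = refl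
xor-intro {false} {false} {false} _ _ = refl
xor-intro {false} {true}  {false} _ ⇒a with () ← ⇒a (inj₁ (refl , refl))
xor-intro {false} {false} {true}  _ ⇒a with () ← ⇒a (inj₂ (refl , refl))

infix 4 _==_
_==_ : Bool → Bool → Bool
x == true  = x
x == false = not x

≡⇔== : ∀ x b → (x ≡ b) ⇔ ((x == b) ≡ true)
≡⇔== x     true  = mk⇔ (λ e → e) (λ e → e)
≡⇔== true  false = mk⇔ (λ ()) (λ ())
≡⇔== false false = mk⇔ (λ _ → refl) (λ _ → refl)

Σ-⊎-inj₁ : {R : A ⊎ B → Set} → (∀ b → ¬ R (inj₂ b)) → Σ (A ⊎ B) R ↔ Σ A (R ∘ inj₁)
Σ-⊎-inj₁ {R = R} ¬R₂ = mk↔ₛ′ to (λ (a , r) → inj₁ a , r) (λ _ → refl) from∘to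
  where
  to : Σ _ R → Σ _ (R ∘ inj₁)
  to (inj₁ a , r) = a , r
  to (inj₂ b , r) = ⊥-elim (¬R₂ b r)
  from∘to : ∀ s → (inj₁ (proj₁ (to s)) , proj₂ (to s)) ≡ s
  from∘to (inj₁ a , r) = refl
  from∘to (inj₂ b , r) = ⊥-elim (¬R₂ b r)

Σ-⊎-inj₂ : {R : A ⊎ B → Set} → (∀ a → ¬ R (inj₁ a)) → Σ (A ⊎ B) R ↔ Σ B (R ∘ inj₂)
Σ-⊎-inj₂ {R = R} ¬R₁ = mk↔ₛ′ to (λ (b , r) → inj₂ b , r) (λ _ → refl) from∘to
  where
  to : Σ _ R → Σ _ (R ∘ inj₂)
  to (inj₁ a , r) = ⊥-elim (¬R₁ a r)
  to (inj₂ b , r) = b , r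
  from∘to : ∀ s → (inj₂ (proj₁ (to s)) , proj₂ (to s)) ≡ s
  from∘to (inj₁ a , r) = ⊥-elim (¬R₁ a r)
  from∘to (inj₂ b , r) = refl

HasSize-unique : HasSize A m → HasSize A n → m ≡ n
HasSize-unique f g = ↔⇒≡ (↔-trans (↔-sym f) g)

HasSize-↣ : HasSize A m → HasSize B n → A ↣ B → m ≤ n
HasSize-↣ f g A↣B = injective⇒≤ (Injection.injective (↔⇒↣ g ↣-∘ (A↣B ↣-∘ ↔⇒↣ (↔-sym f))))

HasSize-Σ : {B : A → Set} → HasSize A m → (∀ a → HasSize (B a) n) → HasSize (Σ A B) (m * n)
HasSize-Σ {m = m} {n = n} |A| |B| = ↔-trans (Σ-↔ |A| (|B| _)) (↔-sym (*↔× {m} {n}))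

Sat : {X : Set} → (X → Bool) → Set
Sat {X} b = Σ X (λ x → b x ≡ true)

Sat-≡ : {X : Set} {b : X → Bool} {x y : Sat b} → proj₁ x ≡ proj₁ y → x ≡ y
Sat-≡ {x = x , e} {y = .x , e′} refl = cong (x ,_) (Bool-≡-irrelevant e e′)

Σ↔Sat : {X : Set} {P : X → Set} {b : X → Bool} →
        (∀ x → Irrelevant (P x)) → (∀ x → P x ⇔ (b x ≡ true)) → Σ X P ↔ Sat b
Σ↔Sat P-irrelevant P⇔b = Σ-↔ ↔-refl (⇔⇒↔ (P-irrelevant _) Bool-≡-irrelevant (P⇔b _))

≡true-cong : {a c : Bool} → a ≡ c → (a ≡ true) ↔ (c ≡ true)
≡true-cong refl = ↔-refl

indicator : Bool → ℕ
indicator b = if b then 1 else 0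

≡true-size : ∀ b → HasSize (b ≡ true) (indicator b)
≡true-size true  = mk↔ₛ′ (λ _ → 0F) (λ _ → refl) (λ { 0F → refl ; (Fin.suc ()) }) (λ _ → Bool-≡-irrelevant _ _)
≡true-size false = mk↔ₛ′ (λ ()) (λ ()) (λ ()) (λ ())

countFin : (Fin n → Bool) → ℕ
countFin {0}     b = 0
countFin {suc n} b = indicator (b 0F) + countFin (b ∘ Fin.suc)

Sat-Fin-suc : (b : Fin (suc n) → Bool) → Sat b ↔ ((b 0F ≡ true) ⊎ Sat (b ∘ Fin.suc))
Sat-Fin-suc b = mk↔ₛ′ to from (λ { (inj₁ _) → refl ; (inj₂ _) → refl }) (λ { (0F , _) → refl ; (Fin.suc _ , _) → refl })
  where
  to : Sat b → (b 0F ≡ true) ⊎ Sat (b ∘ Fin.suc)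
  to (0F        , e) = inj₁ e
  to (Fin.suc i , e) = inj₂ (i , e)
  from : (b 0F ≡ true) ⊎ Sat (b ∘ Fin.suc) → Sat b
  from (inj₁ e)       = 0F , e
  from (inj₂ (i , e)) = Fin.suc i , e

countFin-size : (b : Fin n → Bool) → HasSize (Sat b) (countFin b)
countFin-size {0}     b = mk↔ₛ′ (λ { (() , _) }) (λ ()) (λ ()) (λ { (() , _) })
countFin-size {suc n} b =
  ↔-trans (Sat-Fin-suc b) (↔-trans (≡true-size (b 0F) ⊎-↔ countFin-size (b ∘ Fin.suc)) (↔-sym +↔⊎))

indicator-∧-split : ∀ a c → indicator a ≡ indicator (a ∧ c) + indicator (a ∧ not c)
indicator-∧-split true  true  = refl
indicator-∧-split true  false = refl
indicator-∧-split false c     = refl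

countFin-∧-split : (b c : Fin n → Bool) →
  countFin b ≡ countFin (λ i → b i ∧ c i) + countFin (λ i → b i ∧ not (c i))
countFin-∧-split {0}     b c = refl
countFin-∧-split {suc n} b c = trans
  (cong₂ _+_ (indicator-∧-split (b 0F) (c 0F)) (countFin-∧-split (b ∘ Fin.suc) (c ∘ Fin.suc)))
  (interchange +-commutativeSemigroup (indicator (b 0F ∧ c 0F)) (indicator (b 0F ∧ not (c 0F))) _ _)

countFin-cong : {b c : Fin n → Bool} → (∀ i → b i ≡ c i) → countFin b ≡ countFin c
countFin-cong {0}     b≗c = refl
countFin-cong {suc n} b≗c = cong₂ _+_ (cong indicator (b≗c 0F)) (countFin-cong (b≗c ∘ Fin.suc))

module Count {X : Set} {N : ℕ} (enum : HasSize X N) where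

  -- Opaque, so that count b is a rigid term from which the unifier can read off b.
  opaque
    count : (X → Bool) → ℕ
    count b = countFin (b ∘ Inverse.from enum)

    count-size : ∀ b → HasSize (Sat b) (count b)
    count-size b = ↔-trans
      (Σ-↔ enum (≡true-cong (cong b (sym (Inverse.strictlyInverseʳ enum _)))))
      (countFin-size (b ∘ Inverse.from enum))

    count-cong : ∀ {b c} → (∀ x → b x ≡ c x) → count b ≡ count c
    count-cong b≗c = countFin-cong (b≗c ∘ Inverse.from enum)

    count-∧-split : ∀ (b c : X → Bool) → count b ≡ count (λ x → b x ∧ c x) + count (λ x → b x ∧ not (c x))
    count-∧-split b c = countFin-∧-split (b ∘ Inverse.from enum) (c ∘ Inverse.from enum)

  count-unique : ∀ {b} → HasSize (Sat b) n → count b ≡ n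
  count-unique = HasSize-unique (count-size _)

  count-↔ : ∀ {b c} → Sat b ↔ Sat c → count b ≡ count c
  count-↔ {c = c} b↔c = count-unique (↔-trans b↔c (count-size c))

  count-mono : ∀ {b c} → (∀ x → b x ≡ true → c x ≡ true) → count b ≤ count c
  count-mono {b} {c} b⇒c = HasSize-↣ (count-size b) (count-size c) (mk↣ {to = include} include-injective)
    where
    include : Sat b → Sat c
    include (x , e) = x , b⇒c x e
    include-injective : ∀ {x y} → include x ≡ include y → x ≡ y
    include-injective eq = Sat-≡ (cong proj₁ eq)

  count-single : ∀ {b} x₀ → b x₀ ≡ true → (∀ {x} → b x ≡ true → x ≡ x₀) → count b ≡ 1
  count-single x₀ e₀ unique = count-unique
    (mk↔ₛ′ (λ _ → 0F) (λ _ → x₀ , e₀) (λ { 0F → refl ; (Fin.suc ()) }) (λ (x , e) → Sat-≡ (sym (unique e))))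

  count>0⇒Sat : ∀ {b} → 0 < count b → Sat b
  count>0⇒Sat {b} 0<count = Inverse.from (count-size b) (fromℕ< 0<count)

  Sat⇒0<count : ∀ {b} → Sat b → 0 < count b
  Sat⇒0<count {b} s = ≤-<-trans z≤n (toℕ<n (Inverse.to (count-size b) s))

  count-reflects : ∀ {b} {P : X → Set} → (∀ x → Irrelevant (P x)) → (∀ x → P x ⇔ (b x ≡ true)) →
                   HasSize (Σ X P) n → count b ≡ n
  count-reflects P-irrelevant P⇔b |P| = count-unique (↔-trans (↔-sym (Σ↔Sat P-irrelevant P⇔b)) |P|)

module Plane {q : ℕ} (F : FiniteField q) where
  open FiniteField F
  open PG2 F

  ring : CommutativeRing 0ℓ 0ℓ
  ring = record { isCommutativeRing = isCommutativeRing }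

  open CommutativeRing ring
    using (+-identityʳ; +-identityˡ; *-comm; *-assoc; *-identityˡ; *-identityʳ; zeroʳ; zeroˡ)
  open import Algebra.Properties.Ring (CommutativeRing.ring ring) using (x[y-z]≈xy-xz; [y-z]x≈yx-zx)
  open import Algebra.Properties.Group (CommutativeRing.+-group ring) using (x∙y⁻¹≈ε⇒x≈y; x≈y⇒x∙y⁻¹≈ε)
  open import Algebra.Properties.AbelianGroup (CommutativeRing.+-abelianGroup ring) using (⁻¹-∙-comm)
  open import Algebra.Solver.Ring.NaturalCoefficients.Default (CommutativeRing.commutativeSemiring ring)
    using (solve; _:=_; _:+_; _:*_; con)

  infix 4 _≟_
  _≟_ : DecidableEquality Carrier
  _≟_ = inj⇒≟ (↔⇒↣ (↔-sym enumeration))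

  ≡-irrelevant : {x y : Carrier} → Irrelevant (x ≡ y)
  ≡-irrelevant = Decidable⇒UIP.≡-irrelevant _≟_

  infixl 6 _-_
  _-_ : Carrier → Carrier → Carrier
  x - y = x ⊕ ⊖ y

  1≢0 : ¬ (1# ≡ 0#)
  1≢0 = 0≢1 ∘ sym

  ·-cancelˡ : ∀ {w x y} → ¬ (w ≡ 0#) → w · x ≡ w · y → x ≡ y
  ·-cancelˡ {w} {x} {y} w≢0 wx≡wy with inverse w w≢0
  ... | w⁻¹ , ww⁻¹≡1 = begin
    x                ≡⟨ sym (*-identityˡ x) ⟩
    1# · x           ≡⟨ cong (_· x) (trans (sym ww⁻¹≡1) (*-comm w w⁻¹)) ⟩
    (w⁻¹ · w) · x    ≡⟨ *-assoc w⁻¹ w x ⟩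
    w⁻¹ · (w · x)    ≡⟨ cong (w⁻¹ ·_) wx≡wy ⟩
    w⁻¹ · (w · y)    ≡⟨ sym (*-assoc w⁻¹ w y) ⟩
    (w⁻¹ · w) · y    ≡⟨ cong (_· y) (trans (*-comm w⁻¹ w) ww⁻¹≡1) ⟩
    1# · y           ≡⟨ *-identityˡ y ⟩
    y                ∎
    where open ≡-Reasoning

  -- The semiring solver treats ⊖ x as an atom; these two lemmas turn identities with subtraction
  -- into ⊖-free ones.
  +-swap-sides : ∀ {a b c d} → a ⊕ b ≡ c ⊕ d → a - d ≡ c - b
  +-swap-sides {a} {b} {c} {d} a+b≡c+d = begin
    a - d                          ≡⟨ sym (+-identityʳ _) ⟩
    (a - d) ⊕ 0#                   ≡⟨ cong ((a - d) ⊕_) (sym (x≈y⇒x∙y⁻¹≈ε {b} refl)) ⟩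
    (a - d) ⊕ (b - b)              ≡⟨ regroup₁ a (⊖ d) b (⊖ b) ⟩
    (a ⊕ b) ⊕ (⊖ d ⊕ ⊖ b)          ≡⟨ cong (_⊕ (⊖ d ⊕ ⊖ b)) a+b≡c+d ⟩
    (c ⊕ d) ⊕ (⊖ d ⊕ ⊖ b)          ≡⟨ regroup₂ c d (⊖ d) (⊖ b) ⟩
    (c - b) ⊕ (d - d)              ≡⟨ cong ((c - b) ⊕_) (x≈y⇒x∙y⁻¹≈ε {d} refl) ⟩
    (c - b) ⊕ 0#                   ≡⟨ +-identityʳ _ ⟩
    c - b                          ∎
    where
    open ≡-Reasoning
    regroup₁ : ∀ a d b b′ → (a ⊕ d) ⊕ (b ⊕ b′) ≡ (a ⊕ b) ⊕ (d ⊕ b′)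
    regroup₁ = solve 4 (λ a d b b′ → (a :+ d) :+ (b :+ b′) := (a :+ b) :+ (d :+ b′)) refl
    regroup₂ : ∀ c d d′ b′ → (c ⊕ d) ⊕ (d′ ⊕ b′) ≡ (c ⊕ b′) ⊕ (d ⊕ d′)
    regroup₂ = solve 4 (λ c d d′ b′ → (c :+ d) :+ (d′ :+ b′) := (c :+ b′) :+ (d :+ d′)) refl

  ·-sub-swap : ∀ x y {A B C D} → x · A ⊕ y · B ≡ y · C ⊕ x · D → x · (A - D) ≡ y · (C - B)
  ·-sub-swap x y {A} {B} {C} {D} eq =
    trans (x[y-z]≈xy-xz x A D) (trans (+-swap-sides eq) (sym (x[y-z]≈xy-xz y C B)))

  infixl 6 _-ᵥ_
  _-ᵥ_ : Vec3 → Vec3 → Vec3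
  (x , y , z) -ᵥ (x′ , y′ , z′) = (x - x′ , y - y′ , z - z′)

  0ᵥ : Vec3
  0ᵥ = (0# , 0# , 0#)

  scale : Carrier → Vec3 → Vec3
  scale c (x , y , z) = (c · x , c · y , c · z)

  dot : Vec3 → Vec3 → Carrier
  dot (a , b , c) (x , y , z) = a · x ⊕ b · y ⊕ c · z

  -- The cross product is split into its positive and negative parts, so that dot-sub reduces
  -- facts about it to identities of the semiring solver.
  cross⁺ cross⁻ cross : Vec3 → Vec3 → Vec3
  cross⁺ (a₁ , a₂ , a₃) (b₁ , b₂ , b₃) = (a₂ · b₃ , a₃ · b₁ , a₁ · b₂)
  cross⁻ (a₁ , a₂ , a₃) (b₁ , b₂ , b₃) = (a₃ · b₂ , a₁ · b₃ , a₂ · b₁)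
  cross u v = cross⁺ u v -ᵥ cross⁻ u v

  _⟨_⟩ : Vec3 → Fin 3 → Carrier
  (x , _ , _) ⟨ 0F ⟩ = x
  (_ , y , _) ⟨ 1F ⟩ = y
  (_ , _ , z) ⟨ 2F ⟩ = z

  infix 4 _∥_
  _∥_ : Vec3 → Vec3 → Set
  u ∥ v = ∀ i j → u ⟨ i ⟩ · v ⟨ j ⟩ ≡ u ⟨ j ⟩ · v ⟨ i ⟩

  dot-comm : ∀ u v → dot u v ≡ dot v u
  dot-comm (a , b , c) (x , y , z) =
    solve 6 (λ a b c x y z → a :* x :+ b :* y :+ c :* z := x :* a :+ y :* b :+ z :* c) refl a b c x y z

  dot-scale : ∀ c w v → dot (scale c w) v ≡ c · dot w v
  dot-scale c (a , b , d) (x , y , z) =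
    solve 7 (λ c a b d x y z → (c :* a) :* x :+ (c :* b) :* y :+ (c :* d) :* z := c :* (a :* x :+ b :* y :+ d :* z))
      refl c a b d x y z

  dot-sub : ∀ u u′ w → dot (u -ᵥ u′) w ≡ dot u w - dot u′ w
  dot-sub (a , b , c) (a′ , b′ , c′) (x , y , z) = begin
    (a - a′) · x ⊕ (b - b′) · y ⊕ (c - c′) · z
      ≡⟨ cong₂ _⊕_ (cong₂ _⊕_ ([y-z]x≈yx-zx x a a′) ([y-z]x≈yx-zx y b b′)) ([y-z]x≈yx-zx z c c′) ⟩
    (a · x - a′ · x) ⊕ (b · y - b′ · y) ⊕ (c · z - c′ · z)
      ≡⟨ regroup (a · x) (⊖ (a′ · x)) (b · y) (⊖ (b′ · y)) (c · z) (⊖ (c′ · z)) ⟩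
    (a · x ⊕ b · y ⊕ c · z) ⊕ ((⊖ (a′ · x) ⊕ ⊖ (b′ · y)) ⊕ ⊖ (c′ · z))
      ≡⟨ cong ((a · x ⊕ b · y ⊕ c · z) ⊕_) (trans (cong (_⊕ ⊖ (c′ · z)) (⁻¹-∙-comm _ _)) (⁻¹-∙-comm _ _)) ⟩
    (a · x ⊕ b · y ⊕ c · z) - (a′ · x ⊕ b′ · y ⊕ c′ · z) ∎
    where
    open ≡-Reasoning
    regroup : ∀ p n p′ n′ p″ n″ → (p ⊕ n) ⊕ (p′ ⊕ n′) ⊕ (p″ ⊕ n″) ≡ (p ⊕ p′ ⊕ p″) ⊕ ((n ⊕ n′) ⊕ n″)
    regroup = solve 6 (λ p n p′ n′ p″ n″ →
      (p :+ n) :+ (p′ :+ n′) :+ (p″ :+ n″) := (p :+ p′ :+ p″) :+ ((n :+ n′) :+ n″)) refl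

  dot-crossˡ : ∀ u v → dot (cross u v) u ≡ 0#
  dot-crossˡ u@(x , y , z) v@(x′ , y′ , z′) = trans (dot-sub (cross⁺ u v) (cross⁻ u v) u) (x≈y⇒x∙y⁻¹≈ε
    (solve 6 (λ x y z x′ y′ z′ → (y :* z′) :* x :+ (z :* x′) :* y :+ (x :* y′) :* z
                               := (z :* y′) :* x :+ (x :* z′) :* y :+ (y :* x′) :* z) refl x y z x′ y′ z′))

  dot-crossʳ : ∀ u v → dot (cross u v) v ≡ 0#
  dot-crossʳ u@(x , y , z) v@(x′ , y′ , z′) = trans (dot-sub (cross⁺ u v) (cross⁻ u v) v) (x≈y⇒x∙y⁻¹≈ε
    (solve 6 (λ x y z x′ y′ z′ → (y :* z′) :* x′ :+ (z :* x′) :* y′ :+ (x :* y′) :* z′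
                               := (z :* y′) :* x′ :+ (x :* z′) :* y′ :+ (y :* x′) :* z′) refl x y z x′ y′ z′))

  mk∥ : ∀ {x y z x′ y′ z′} → y · z′ ≡ z · y′ → z · x′ ≡ x · z′ → x · y′ ≡ y · x′ →
        (x , y , z) ∥ (x′ , y′ , z′)
  mk∥ yz zx xy 0F 0F = refl
  mk∥ yz zx xy 0F 1F = xy
  mk∥ yz zx xy 0F 2F = sym zx
  mk∥ yz zx xy 1F 0F = sym xy
  mk∥ yz zx xy 1F 1F = refl
  mk∥ yz zx xy 1F 2F = yz
  mk∥ yz zx xy 2F 0F = zx
  mk∥ yz zx xy 2F 1F = sym yz
  mk∥ yz zx xy 2F 2F = refl

  cross≡0⇒∥ : ∀ {u v} → cross u v ≡ 0ᵥ → u ∥ v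
  cross≡0⇒∥ eq = mk∥ (x∙y⁻¹≈ε⇒x≈y _ _ (cong proj₁ eq))
                     (x∙y⁻¹≈ε⇒x≈y _ _ (cong (proj₁ ∘ proj₂) eq))
                     (x∙y⁻¹≈ε⇒x≈y _ _ (cong (proj₂ ∘ proj₂) eq))

  nonzero-coordinate : ∀ {w} → ¬ (w ≡ 0ᵥ) → Σ (Fin 3) (λ k → ¬ (w ⟨ k ⟩ ≡ 0#))
  nonzero-coordinate {x , y , z} w≢0 with x ≟ 0# | y ≟ 0# | z ≟ 0#
  ... | no x≢0   | _        | _        = 0F , x≢0
  ... | yes _    | no y≢0   | _        = 1F , y≢0
  ... | yes _    | yes _    | no z≢0   = 2F , z≢0
  ... | yes refl | yes refl | yes refl = ⊥-elim (w≢0 refl)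

  ∥-through : ∀ {u v w} → ¬ (w ≡ 0ᵥ) → u ∥ w → v ∥ w → u ∥ v
  ∥-through {u} {v} {w} w≢0 u∥w v∥w i j with nonzero-coordinate w≢0
  ... | k , wₖ≢0 = ·-cancelˡ wₖ≢0 (begin
    w ⟨ k ⟩ · (u ⟨ i ⟩ · v ⟨ j ⟩)   ≡⟨ swap₁ _ _ _ ⟩
    (u ⟨ i ⟩ · w ⟨ k ⟩) · v ⟨ j ⟩   ≡⟨ cong (_· v ⟨ j ⟩) (u∥w i k) ⟩
    (u ⟨ k ⟩ · w ⟨ i ⟩) · v ⟨ j ⟩   ≡⟨ swap₂ _ _ _ ⟩
    u ⟨ k ⟩ · (v ⟨ j ⟩ · w ⟨ i ⟩)   ≡⟨ cong (u ⟨ k ⟩ ·_) (v∥w j i) ⟩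
    u ⟨ k ⟩ · (v ⟨ i ⟩ · w ⟨ j ⟩)   ≡⟨ swap₃ _ _ _ ⟩
    (u ⟨ k ⟩ · w ⟨ j ⟩) · v ⟨ i ⟩   ≡⟨ cong (_· v ⟨ i ⟩) (u∥w k j) ⟩
    (u ⟨ j ⟩ · w ⟨ k ⟩) · v ⟨ i ⟩   ≡⟨ sym (swap₁ _ _ _) ⟩
    w ⟨ k ⟩ · (u ⟨ j ⟩ · v ⟨ i ⟩)   ∎)
    where
    open ≡-Reasoning
    swap₁ : ∀ a b c → a · (b · c) ≡ (b · a) · c
    swap₁ = solve 3 (λ a b c → a :* (b :* c) := (b :* a) :* c) refl
    swap₂ : ∀ a b c → (a · b) · c ≡ a · (c · b)
    swap₂ = solve 3 (λ a b c → (a :* b) :* c := a :* (c :* b)) refl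
    swap₃ : ∀ a b c → a · (b · c) ≡ (a · c) · b
    swap₃ = solve 3 (λ a b c → a :* (b :* c) := (a :* c) :* b) refl

  1·x≡y·1 : ∀ {x y} → 1# · x ≡ y · 1# → x ≡ y
  1·x≡y·1 {x} {y} eq = trans (sym (*-identityˡ x)) (trans eq (*-identityʳ y))
  1·1≢x·0 : ∀ {x} → ¬ (1# · 1# ≡ x · 0#)
  1·1≢x·0 {x} eq = 1≢0 (trans (sym (*-identityʳ 1#)) (trans eq (zeroʳ x)))
  0·x≢1·1 : ∀ {x} → ¬ (0# · x ≡ 1# · 1#)
  0·x≢1·1 {x} eq = 0≢1 (trans (sym (zeroˡ x)) (trans eq (*-identityʳ 1#)))

  normalized-∥ : ∀ {u v} → Normalized u → Normalized v → u ∥ v → u ≡ v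
  normalized-∥ (inj₁ refl) (inj₁ refl) u∥v =
    cong₂ (λ y z → 1# , y , z) (sym (1·x≡y·1 (u∥v 0F 1F))) (sym (1·x≡y·1 (u∥v 0F 2F)))
  normalized-∥ (inj₁ refl) (inj₂ (inj₁ (refl , refl))) u∥v = ⊥-elim (1·1≢x·0 (u∥v 0F 1F))
  normalized-∥ (inj₁ refl) (inj₂ (inj₂ (refl , refl , refl))) u∥v = ⊥-elim (1·1≢x·0 (u∥v 0F 2F))
  normalized-∥ (inj₂ (inj₁ (refl , refl))) (inj₁ refl) u∥v = ⊥-elim (0·x≢1·1 (u∥v 0F 1F))
  normalized-∥ (inj₂ (inj₁ (refl , refl))) (inj₂ (inj₁ (refl , refl))) u∥v =
    cong (λ z → 0# , 1# , z) (sym (1·x≡y·1 (u∥v 1F 2F)))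
  normalized-∥ (inj₂ (inj₁ (refl , refl))) (inj₂ (inj₂ (refl , refl , refl))) u∥v = ⊥-elim (1·1≢x·0 (u∥v 1F 2F))
  normalized-∥ (inj₂ (inj₂ (refl , refl , refl))) (inj₁ refl) u∥v = ⊥-elim (0·x≢1·1 (u∥v 0F 2F))
  normalized-∥ (inj₂ (inj₂ (refl , refl , refl))) (inj₂ (inj₁ (refl , refl))) u∥v = ⊥-elim (0·x≢1·1 (u∥v 1F 2F))
  normalized-∥ (inj₂ (inj₂ (refl , refl , refl))) (inj₂ (inj₂ (refl , refl , refl))) u∥v = refl

  ⊥-both⇒∥-cross : ∀ a b c → dot a c ≡ 0# → dot b c ≡ 0# → c ∥ cross a b
  ⊥-both⇒∥-cross (a₁ , a₂ , a₃) (b₁ , b₂ , b₃) (c₁ , c₂ , c₃) a·c≡0 b·c≡0 = mk∥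
    (·-sub-swap c₂ c₃ (drop-zero-terms (expand₁ a₁ a₂ a₃ b₁ b₂ b₃ c₁ c₂ c₃)))
    (·-sub-swap c₃ c₁ (drop-zero-terms (expand₂ a₁ a₂ a₃ b₁ b₂ b₃ c₁ c₂ c₃)))
    (·-sub-swap c₁ c₂ (drop-zero-terms (expand₃ a₁ a₂ a₃ b₁ b₂ b₃ c₁ c₂ c₃)))
    where
    drop-zero-terms : ∀ {X Y s t} →
      X ⊕ s · dot (a₁ , a₂ , a₃) (c₁ , c₂ , c₃) ≡ Y ⊕ t · dot (b₁ , b₂ , b₃) (c₁ , c₂ , c₃) → X ≡ Y
    drop-zero-terms {X} {Y} {s} {t} eq = begin
      X                                      ≡⟨ sym (+-identityʳ X) ⟩
      X ⊕ 0#                                 ≡⟨ cong (X ⊕_) (sym (trans (cong (s ·_) a·c≡0) (zeroʳ s))) ⟩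
      X ⊕ s · dot (a₁ , a₂ , a₃) (c₁ , c₂ , c₃) ≡⟨ eq ⟩
      Y ⊕ t · dot (b₁ , b₂ , b₃) (c₁ , c₂ , c₃) ≡⟨ cong (Y ⊕_) (trans (cong (t ·_) b·c≡0) (zeroʳ t)) ⟩
      Y ⊕ 0#                                 ≡⟨ +-identityʳ Y ⟩
      Y                                      ∎
      where open ≡-Reasoning
    expand₁ : ∀ a₁ a₂ a₃ b₁ b₂ b₃ c₁ c₂ c₃ →
      c₂ · (a₁ · b₂) ⊕ c₃ · (a₁ · b₃) ⊕ b₁ · (a₁ · c₁ ⊕ a₂ · c₂ ⊕ a₃ · c₃)
        ≡ c₃ · (a₃ · b₁) ⊕ c₂ · (a₂ · b₁) ⊕ a₁ · (b₁ · c₁ ⊕ b₂ · c₂ ⊕ b₃ · c₃)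
    expand₁ = solve 9 (λ a₁ a₂ a₃ b₁ b₂ b₃ c₁ c₂ c₃ →
      c₂ :* (a₁ :* b₂) :+ c₃ :* (a₁ :* b₃) :+ b₁ :* (a₁ :* c₁ :+ a₂ :* c₂ :+ a₃ :* c₃)
        := c₃ :* (a₃ :* b₁) :+ c₂ :* (a₂ :* b₁) :+ a₁ :* (b₁ :* c₁ :+ b₂ :* c₂ :+ b₃ :* c₃)) refl
    expand₂ : ∀ a₁ a₂ a₃ b₁ b₂ b₃ c₁ c₂ c₃ →
      c₃ · (a₂ · b₃) ⊕ c₁ · (a₂ · b₁) ⊕ b₂ · (a₁ · c₁ ⊕ a₂ · c₂ ⊕ a₃ · c₃)
        ≡ c₁ · (a₁ · b₂) ⊕ c₃ · (a₃ · b₂) ⊕ a₂ · (b₁ · c₁ ⊕ b₂ · c₂ ⊕ b₃ · c₃)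
    expand₂ = solve 9 (λ a₁ a₂ a₃ b₁ b₂ b₃ c₁ c₂ c₃ →
      c₃ :* (a₂ :* b₃) :+ c₁ :* (a₂ :* b₁) :+ b₂ :* (a₁ :* c₁ :+ a₂ :* c₂ :+ a₃ :* c₃)
        := c₁ :* (a₁ :* b₂) :+ c₃ :* (a₃ :* b₂) :+ a₂ :* (b₁ :* c₁ :+ b₂ :* c₂ :+ b₃ :* c₃)) refl
    expand₃ : ∀ a₁ a₂ a₃ b₁ b₂ b₃ c₁ c₂ c₃ →
      c₁ · (a₃ · b₁) ⊕ c₂ · (a₃ · b₂) ⊕ b₃ · (a₁ · c₁ ⊕ a₂ · c₂ ⊕ a₃ · c₃)
        ≡ c₂ · (a₂ · b₃) ⊕ c₁ · (a₁ · b₃) ⊕ a₃ · (b₁ · c₁ ⊕ b₂ · c₂ ⊕ b₃ · c₃)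
    expand₃ = solve 9 (λ a₁ a₂ a₃ b₁ b₂ b₃ c₁ c₂ c₃ →
      c₁ :* (a₃ :* b₁) :+ c₂ :* (a₃ :* b₂) :+ b₃ :* (a₁ :* c₁ :+ a₂ :* c₂ :+ a₃ :* c₃)
        := c₂ :* (a₂ :* b₃) :+ c₁ :* (a₁ :* b₃) :+ a₃ :* (b₁ :* c₁ :+ b₂ :* c₂ :+ b₃ :* c₃)) refl

  Normalized-irrelevant : ∀ v → Irrelevant (Normalized v)
  Normalized-irrelevant (x , y , z) =
    ⊎-irrelevant ≡-irrelevant
      (⊎-irrelevant (×-irrelevant ≡-irrelevant ≡-irrelevant)
                    (×-irrelevant ≡-irrelevant (×-irrelevant ≡-irrelevant ≡-irrelevant))
                    (λ (_ , y≡1) (_ , y≡0 , _) → 0≢1 (trans (sym y≡0) y≡1)))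
      (λ x≡1 → [ (λ (x≡0 , _) → 0≢1 (trans (sym x≡0) x≡1)) , (λ (x≡0 , _) → 0≢1 (trans (sym x≡0) x≡1)) ]′)

  Normalized? : ∀ v → Dec (Normalized v)
  Normalized? (x , y , z) = x ≟ 1# ⊎-dec ((x ≟ 0# ×-dec y ≟ 1#) ⊎-dec (x ≟ 0# ×-dec (y ≟ 0# ×-dec z ≟ 1#)))

  Point-≡ : {p r : Point} → proj₁ p ≡ proj₁ r → p ≡ r
  Point-≡ {v , n} {.v , n′} refl = cong (v ,_) (Normalized-irrelevant v n n′)

  infix 4 _≟ₚ_
  _≟ₚ_ : DecidableEquality Point
  p ≟ₚ r = map′ Point-≡ (cong proj₁) (Prodₚ.≡-dec _≟_ (Prodₚ.≡-dec _≟_ _≟_) (proj₁ p) (proj₁ r))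

  Vec3-size : HasSize Vec3 (q * (q * q))
  Vec3-size = ↔-trans (F↔q ×-↔ (F↔q ×-↔ F↔q)) (↔-trans (↔-refl ×-↔ ↔-sym *↔×) (↔-sym *↔×))
    where
    F↔q : Carrier ↔ Fin q
    F↔q = ↔-sym enumeration

  Point-size : HasSize Point (Count.count Vec3-size (does ∘ Normalized?))
  Point-size = ↔-trans (Σ↔Sat Normalized-irrelevant (does⇔ ∘ Normalized?)) (Count.count-size Vec3-size _)

  normalize : ∀ w → ¬ (w ≡ 0ᵥ) → Σ Point (λ P → Σ Carrier (λ c → proj₁ P ≡ scale c w))
  normalize (a , b , c) w≢0 with a ≟ 0#
  ... | no a≢0 with inverse a a≢0
  ...   | a⁻¹ , aa⁻¹≡1 = ((a⁻¹ · a , a⁻¹ · b , a⁻¹ · c) , inj₁ (trans (*-comm a⁻¹ a) aa⁻¹≡1)) , a⁻¹ , refl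
  normalize (a , b , c) w≢0 | yes refl with b ≟ 0#
  ... | no b≢0 with inverse b b≢0
  ...   | b⁻¹ , bb⁻¹≡1 =
    ((b⁻¹ · 0# , b⁻¹ · b , b⁻¹ · c) , inj₂ (inj₁ (zeroʳ b⁻¹ , trans (*-comm b⁻¹ b) bb⁻¹≡1))) , b⁻¹ , refl
  normalize (a , b , c) w≢0 | yes refl | yes refl with c ≟ 0#
  ... | yes refl = ⊥-elim (w≢0 refl)
  ... | no c≢0 with inverse c c≢0
  ...   | c⁻¹ , cc⁻¹≡1 =
    ((c⁻¹ · 0# , c⁻¹ · 0# , c⁻¹ · c) , inj₂ (inj₂ (zeroʳ c⁻¹ , zeroʳ c⁻¹ , trans (*-comm c⁻¹ c) cc⁻¹≡1))) ,
    c⁻¹ , refl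

  -- Opaque for the same reason as count: inc p L must determine p and L.
  opaque
    Incident? : ∀ p L → Dec (Incident p L)
    Incident? p L = dot (proj₁ L) (proj₁ p) ≟ 0#

    inc : Point → Line → Bool
    inc p L = does (Incident? p L)

    Incident⇔inc : ∀ {p L} → Incident p L ⇔ (inc p L ≡ true)
    Incident⇔inc {p} {L} = does⇔ (Incident? p L)

    inc-sym : ∀ p L → inc p L ≡ inc L p
    inc-sym p L = does-⇔ (mk⇔ (trans (dot-comm _ _)) (trans (dot-comm _ _))) (Incident? p L) (Incident? L p)

  Incident-irrelevant : ∀ {p L} → Irrelevant (Incident p L)
  Incident-irrelevant = ≡-irrelevant

  ¬Incident⇔inc : ∀ {p L} → (¬ Incident p L) ⇔ (inc p L ≡ false)
  ¬Incident⇔inc = mk⇔ (λ ¬I → ¬-not (¬I ∘ Equivalence.from Incident⇔inc))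
                      (λ p∉L I → case trans (sym (Equivalence.to Incident⇔inc I)) p∉L of λ ())

  inc-flip : ∀ {p L} → inc p L ≡ true → inc L p ≡ true
  inc-flip {p} {L} = trans (sym (inc-sym p L))

  inc⇒⊥ : ∀ {p L} → inc p L ≡ true → dot (proj₁ p) (proj₁ L) ≡ 0#
  inc⇒⊥ {p} {L} pL = trans (dot-comm _ _) (Equivalence.from Incident⇔inc pL)

  cross-nonzero : ∀ (p r : Point) → ¬ p ≡ r → ¬ (cross (proj₁ p) (proj₁ r) ≡ 0ᵥ)
  cross-nonzero p r p≢r eq = p≢r (Point-≡ (normalized-∥ (proj₂ p) (proj₂ r) (cross≡0⇒∥ eq)))

  join : (p r : Point) → ¬ p ≡ r → Line
  join p r p≢r = proj₁ (normalize (cross (proj₁ p) (proj₁ r)) (cross-nonzero p r p≢r))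

  dot-scaled≡0 : ∀ {u w} c v → u ≡ scale c w → dot w v ≡ 0# → dot u v ≡ 0#
  dot-scaled≡0 c v refl w·v≡0 = trans (dot-scale c _ v) (trans (cong (c ·_) w·v≡0) (zeroʳ c))

  join-incident : ∀ p r p≢r → inc p (join p r p≢r) ≡ true × inc r (join p r p≢r) ≡ true
  join-incident p r p≢r =
    let _ , c , J≡c·p×r = normalize (cross (proj₁ p) (proj₁ r)) (cross-nonzero p r p≢r)
    in Equivalence.to Incident⇔inc (dot-scaled≡0 c _ J≡c·p×r (dot-crossˡ _ _)) ,
       Equivalence.to Incident⇔inc (dot-scaled≡0 c _ J≡c·p×r (dot-crossʳ _ _))

  two-points-one-line : ∀ {p r L L′} → ¬ p ≡ r →
    inc p L ≡ true → inc r L ≡ true → inc p L′ ≡ true → inc r L′ ≡ true → L ≡ L′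
  two-points-one-line {p} {r} {L} {L′} p≢r pL rL pL′ rL′ = Point-≡ (normalized-∥ (proj₂ L) (proj₂ L′)
    (∥-through (cross-nonzero p r p≢r)
      (⊥-both⇒∥-cross (proj₁ p) (proj₁ r) (proj₁ L) (inc⇒⊥ pL) (inc⇒⊥ rL))
      (⊥-both⇒∥-cross (proj₁ p) (proj₁ r) (proj₁ L′) (inc⇒⊥ pL′) (inc⇒⊥ rL′))))

  two-lines-one-point : ∀ {L L′ p r} → ¬ L ≡ L′ →
    inc p L ≡ true → inc p L′ ≡ true → inc r L ≡ true → inc r L′ ≡ true → p ≡ r
  two-lines-one-point L≢L′ pL pL′ rL rL′ =
    two-points-one-line L≢L′ (inc-flip pL) (inc-flip pL′) (inc-flip rL) (inc-flip rL′)

  -- A line is also a point of the dual plane, and the meet of two lines is their join there.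
  meet : (L L′ : Line) → ¬ L ≡ L′ → Point
  meet = join

  meet-incident : ∀ L L′ L≢L′ → inc (meet L L′ L≢L′) L ≡ true × inc (meet L L′ L≢L′) L′ ≡ true
  meet-incident L L′ L≢L′ = inc-flip (proj₁ (join-incident L L′ L≢L′)) , inc-flip (proj₂ (join-incident L L′ L≢L′))

  open Count Point-size public

  perspectivity : ∀ {p L} → inc p L ≡ false → (c : Point → Bool) (d : Line → Bool) →
    (∀ {r N} → inc r L ≡ true → inc p N ≡ true → inc r N ≡ true → d N ≡ c r) →
    count (λ r → inc r L ∧ c r) ≡ count (λ N → inc p N ∧ d N)
  perspectivity {p} {L} p∉L c d d≡c = count-↔ (mk↔ₛ′ to from to∘from from∘to)
    where
    p≢ : ∀ {r} → inc r L ≡ true → ¬ p ≡ r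
    p≢ r∈L = ≢-by (λ x → inc x L) r∈L p∉L ∘ sym
    ≢L : ∀ {N} → inc p N ≡ true → ¬ N ≡ L
    ≢L p∈N = ≢-by (inc p) p∈N p∉L
    to : Sat (λ r → inc r L ∧ c r) → Sat (λ N → inc p N ∧ d N)
    to (r , e) =
      let p∈N , r∈N = join-incident p r (p≢ (∧-elimˡ e))
      in join p r (p≢ (∧-elimˡ e)) , ∧-intro p∈N (trans (d≡c (∧-elimˡ e) p∈N r∈N) (∧-elimʳ e))
    from : Sat (λ N → inc p N ∧ d N) → Sat (λ r → inc r L ∧ c r)
    from (N , e) =
      let r∈N , r∈L = meet-incident N L (≢L (∧-elimˡ e))
      in meet N L (≢L (∧-elimˡ e)) , ∧-intro r∈L (trans (sym (d≡c r∈L (∧-elimˡ e) r∈N)) (∧-elimʳ e))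
    to∘from : ∀ s → to (from s) ≡ s
    to∘from (N , e) =
      let r∈N , r∈L = meet-incident N L (≢L (∧-elimˡ e))
          p∈J , r∈J = join-incident p (meet N L (≢L (∧-elimˡ e))) (p≢ r∈L)
      in Sat-≡ (two-points-one-line (p≢ r∈L) p∈J r∈J (∧-elimˡ e) r∈N)
    from∘to : ∀ s → from (to s) ≡ s
    from∘to (r , e) =
      let p∈N , r∈N = join-incident p r (p≢ (∧-elimˡ e))
          r′∈N , r′∈L = meet-incident (join p r (p≢ (∧-elimˡ e))) L (≢L p∈N)
      in Sat-≡ (two-lines-one-point (≢L p∈N) r′∈N r′∈L r∈N (∧-elimˡ e))

  z=0 : Line
  z=0 = (0# , 0# , 1#) , inj₂ (inj₂ (refl , refl , refl))

  dot-z=0 : ∀ x y z → dot (0# , 0# , 1#) (x , y , z) ≡ z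
  dot-z=0 = solve 3 (λ x y z → con 0 :* x :+ con 0 :* y :+ con 1 :* z := z) refl

  on-z=0 : ∀ {p} → inc p z=0 ≡ true → proj₂ (proj₂ (proj₁ p)) ≡ 0#
  on-z=0 {(x , y , z) , _} p∈z=0 = trans (sym (dot-z=0 x y z)) (Equivalence.from Incident⇔inc p∈z=0)

  points-of-z=0 : Sat (λ r → inc r z=0) ↔ (⊤ ⊎ Carrier)
  points-of-z=0 = mk↔ₛ′ to from (λ { (inj₁ tt) → refl ; (inj₂ y) → refl }) from∘to
    where
    to : Sat (λ r → inc r z=0) → ⊤ ⊎ Carrier
    to (((_ , y , _) , inj₁ _)                 , _) = inj₂ y
    to ((_           , inj₂ (inj₁ _))          , _) = inj₁ tt
    to ((_           , inj₂ (inj₂ (_ , _ , z≡1))) , e) = ⊥-elim (1≢0 (trans (sym z≡1) (on-z=0 e)))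
    from : ⊤ ⊎ Carrier → Sat (λ r → inc r z=0)
    from (inj₁ tt) = ((0# , 1# , 0#) , inj₂ (inj₁ (refl , refl))) , Equivalence.to Incident⇔inc (dot-z=0 0# 1# 0#)
    from (inj₂ y)  = ((1# , y , 0#) , inj₁ refl) , Equivalence.to Incident⇔inc (dot-z=0 1# y 0#)
    from∘to : ∀ s → from (to s) ≡ s
    from∘to (((_ , y , _) , inj₁ refl) , e) = Sat-≡ (Point-≡ (cong (λ z → 1# , y , z) (sym (on-z=0 e))))
    from∘to ((_ , inj₂ (inj₁ (refl , refl))) , e) = Sat-≡ (Point-≡ (cong (λ z → 0# , 1# , z) (sym (on-z=0 e))))
    from∘to ((_ , inj₂ (inj₂ (_ , _ , z≡1))) , e) = ⊥-elim (1≢0 (trans (sym z≡1) (on-z=0 e)))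

  Normalized⇒≢0ᵥ : ∀ {v} → Normalized v → ¬ v ≡ 0ᵥ
  Normalized⇒≢0ᵥ (inj₁ x≡1)                refl = 0≢1 x≡1
  Normalized⇒≢0ᵥ (inj₂ (inj₁ (_ , y≡1)))     refl = 0≢1 y≡1
  Normalized⇒≢0ᵥ (inj₂ (inj₂ (_ , _ , z≡1))) refl = 0≢1 z≡1

  c₁ c₂ c₃ : Point
  c₁ = (0# , 0# , 1#) , inj₂ (inj₂ (refl , refl , refl))
  c₂ = (1# , 0# , 1#) , inj₁ refl
  c₃ = (0# , 1# , 1#) , inj₂ (inj₁ (refl , refl))

  c₁c₂c₃-not-collinear : ∀ {L} → inc c₁ L ≡ true → inc c₂ L ≡ true → inc c₃ L ≡ true → ⊥
  c₁c₂c₃-not-collinear {(a , b , c) , L-normalized} c₁∈L c₂∈L c₃∈L =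
    Normalized⇒≢0ᵥ L-normalized (cong₂ _,_ a≡0 (cong₂ _,_ b≡0 c≡0))
    where
    c≡0 : c ≡ 0#
    c≡0 = trans (sym (solve 3 (λ a b c → a :* con 0 :+ b :* con 0 :+ c :* con 1 := c) refl a b c))
                (Equivalence.from Incident⇔inc c₁∈L)
    a≡0 : a ≡ 0#
    a≡0 = begin
      a                          ≡⟨ solve 2 (λ a b → a := a :* con 1 :+ b :* con 0 :+ con 0 :* con 1) refl a b ⟩
      a · 1# ⊕ b · 0# ⊕ 0# · 1#  ≡⟨ cong (λ t → a · 1# ⊕ b · 0# ⊕ t · 1#) (sym c≡0) ⟩
      a · 1# ⊕ b · 0# ⊕ c · 1#   ≡⟨ Equivalence.from Incident⇔inc c₂∈L ⟩
      0#                         ∎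
      where open ≡-Reasoning
    b≡0 : b ≡ 0#
    b≡0 = begin
      b                          ≡⟨ solve 2 (λ a b → b := a :* con 0 :+ b :* con 1 :+ con 0 :* con 1) refl a b ⟩
      a · 0# ⊕ b · 1# ⊕ 0# · 1#  ≡⟨ cong (λ t → a · 0# ⊕ b · 1# ⊕ t · 1#) (sym c≡0) ⟩
      a · 0# ⊕ b · 1# ⊕ c · 1#   ≡⟨ Equivalence.from Incident⇔inc c₃∈L ⟩
      0#                         ∎
      where open ≡-Reasoning

  off-z=0 : ∀ {x y n} → inc ((x , y , 1#) , n) z=0 ≡ false
  off-z=0 {x} {y} {n} = ¬-not (λ on → 1≢0 (on-z=0 {(x , y , 1#) , n} on))

  point-off-z=0-and : ∀ L → Σ Point (λ p → inc p L ≡ false × inc p z=0 ≡ false)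
  point-off-z=0-and L with inc c₁ L in c₁∈L | inc c₂ L in c₂∈L | inc c₃ L in c₃∈L
  ... | false | _     | _     = c₁ , c₁∈L , off-z=0
  ... | true  | false | _     = c₂ , c₂∈L , off-z=0
  ... | true  | true  | false = c₃ , c₃∈L , off-z=0
  ... | true  | true  | true  = ⊥-elim (c₁c₂c₃-not-collinear c₁∈L c₂∈L c₃∈L)

  z=0-size : count (λ r → inc r z=0) ≡ suc q
  z=0-size = count-unique (↔-trans points-of-z=0 (↔-trans (↔-sym 1↔⊤ ⊎-↔ ↔-sym enumeration) (↔-sym (+↔⊎ {1} {q}))))

  line-size≡pencil-size : ∀ {p L} → inc p L ≡ false → count (λ r → inc r L) ≡ count (λ N → inc p N)
  line-size≡pencil-size {p} {L} p∉L = begin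
    count (λ r → inc r L)          ≡⟨ count-cong (λ r → sym (∧-identityʳ (inc r L))) ⟩
    count (λ r → inc r L ∧ true)   ≡⟨ perspectivity p∉L (λ _ → true) (λ _ → true) (λ _ _ _ → refl) ⟩
    count (λ N → inc p N ∧ true)   ≡⟨ count-cong (λ N → ∧-identityʳ (inc p N)) ⟩
    count (λ N → inc p N)          ∎
    where open ≡-Reasoning

  line-size : ∀ L → count (λ r → inc r L) ≡ suc q
  line-size L = via (point-off-z=0-and L)
    where
    via : Σ Point (λ p → inc p L ≡ false × inc p z=0 ≡ false) → count (λ r → inc r L) ≡ suc q
    via (p , p∉L , p∉z=0) = trans (line-size≡pencil-size p∉L) (trans (sym (line-size≡pencil-size p∉z=0)) z=0-size)

  pencil-size : ∀ p → count (λ L → inc p L) ≡ suc q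
  pencil-size p = trans (count-cong (inc-sym p)) (line-size p)

  line-minus-line : ∀ {L L′} → ¬ L ≡ L′ → count (λ r → inc r L ∧ not (inc r L′)) ≡ q
  line-minus-line {L} {L′} L≢L′ = suc-injective (begin
    suc (count (λ r → inc r L ∧ not (inc r L′)))
      ≡⟨ cong (_+ count (λ r → inc r L ∧ not (inc r L′))) (sym meets-once) ⟩
    count (λ r → inc r L ∧ inc r L′) + count (λ r → inc r L ∧ not (inc r L′))
      ≡⟨ sym (count-∧-split _ _) ⟩
    count (λ r → inc r L)
      ≡⟨ line-size L ⟩
    suc q ∎)
    where
    open ≡-Reasoning
    meets-once : count (λ r → inc r L ∧ inc r L′) ≡ 1
    meets-once =
      let r₀∈L , r₀∈L′ = meet-incident L L′ L≢L′
      in count-single (meet L L′ L≢L′) (∧-intro r₀∈L r₀∈L′)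
                      (λ e → two-lines-one-point L≢L′ (∧-elimˡ e) (∧-elimʳ e) r₀∈L r₀∈L′)

  pencil-minus-pencil : ∀ {p p′} → ¬ p ≡ p′ → count (λ L → inc p L ∧ not (inc p′ L)) ≡ q
  pencil-minus-pencil {p} {p′} p≢p′ =
    trans (count-cong (λ L → cong₂ (λ a b → a ∧ not b) (inc-sym p L) (inc-sym p′ L))) (line-minus-line p≢p′)

  module MaximalArc {k : ℕ} (0<k : 0 < k) (M : Point → Bool)
    (0-or-k : ∀ L → count (λ r → inc r L ∧ M r) ≡ 0 ⊎ count (λ r → inc r L ∧ M r) ≡ k) where

    open Equivalence using (to; from)

    secant : Line → Bool
    secant L = does (1 ≤? count (λ r → inc r L ∧ M r))

    secant-size : ∀ {L} → secant L ≡ true → count (λ r → inc r L ∧ M r) ≡ k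
    secant-size {L} secant-L =
      [ (λ |L∩M|≡0 → case subst (1 ≤_) |L∩M|≡0 (from (does⇔ (1 ≤? _)) secant-L) of λ ()) , id ]′ (0-or-k L)

    secant-intro : ∀ {r L} → inc r L ≡ true → M r ≡ true → secant L ≡ true
    secant-intro r∈L r∈M = to (does⇔ (1 ≤? _)) (Sat⇒0<count (_ , ∧-intro r∈L r∈M))

    secant-point : ∀ {L} → secant L ≡ true → Σ Point (λ m → inc m L ≡ true × M m ≡ true)
    secant-point secant-L = let m , e = count>0⇒Sat (from (does⇔ (1 ≤? _)) secant-L) in m , ∧-elimˡ e , ∧-elimʳ e

    -- Each point of M lies on exactly one line through p, and each secant carries k points of M.
    secants-through : ∀ {p} → M p ≡ false → count (λ L → inc p L ∧ secant L) * k ≡ count M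
    secants-through {p} p∉M = sym (count-unique (↔-trans flags (HasSize-Σ (count-size _) (λ (L , e) →
      subst (HasSize _) (secant-size (∧-elimʳ e)) (count-size _)))))
      where
      Flag : Set
      Flag = Σ (Sat (λ L → inc p L ∧ secant L)) (λ (L , _) → Sat (λ r → inc r L ∧ M r))
      p≢ : ∀ {m} → M m ≡ true → ¬ p ≡ m
      p≢ m∈M = ≢-by M m∈M p∉M ∘ sym
      flag-≡ : ∀ {L L′ a a′ r e e′} → L ≡ L′ → _≡_ {A = Flag} ((L , a) , (r , e)) ((L′ , a′) , (r , e′))
      flag-≡ {L} {r = r} refl = cong₂ (λ a e → (L , a) , (r , e)) (Bool-≡-irrelevant _ _) (Bool-≡-irrelevant _ _)
      flag : Sat M → Flag
      flag (m , m∈M) =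
        let p∈J , m∈J = join-incident p m (p≢ m∈M)
        in (join p m (p≢ m∈M) , ∧-intro p∈J (secant-intro m∈J m∈M)) , (m , ∧-intro m∈J m∈M)
      point : Flag → Sat M
      point (_ , (r , e)) = r , ∧-elimʳ e
      flag∘point : ∀ f → flag (point f) ≡ f
      flag∘point ((L , a) , (r , e)) =
        let p∈J , r∈J = join-incident p r (p≢ (∧-elimʳ e))
        in flag-≡ (two-points-one-line (p≢ (∧-elimʳ e)) p∈J r∈J (∧-elimˡ a) (∧-elimˡ e))
      flags : Sat M ↔ Flag
      flags = mk↔ₛ′ flag point flag∘point (λ _ → Sat-≡ refl)

n+x≡1+2n⇒x≡1+n : ∀ n {x} → n + x ≡ suc (2 * n) → x ≡ suc n
n+x≡1+2n⇒x≡1+n n {x} eq = +-cancelˡ-≡ n x (suc n) (trans eq (sym (n+1+n≡1+2n n)))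
  where
  n+1+n≡1+2n : ∀ n → n + suc n ≡ suc (2 * n)
  n+1+n≡1+2n = solve-∀

1+n≤x⇒1+2n≤2x : ∀ {n x} → suc n ≤ x → suc (2 * n) ≤ 2 * x
1+n≤x⇒1+2n≤2x {n} {x} 1+n≤x = begin
  suc (2 * n)        ≤⟨ n≤1+n _ ⟩
  suc (suc (2 * n))  ≡⟨ 2+2n≡2[1+n] n ⟩
  2 * suc n          ≤⟨ *-monoʳ-≤ 2 1+n≤x ⟩
  2 * x              ∎
  where
  open ≤-Reasoning
  2+2n≡2[1+n] : ∀ n → suc (suc (2 * n)) ≡ 2 * suc n
  2+2n≡2[1+n] = solve-∀

1+n≤2n : ∀ {n} → 1 ≤ n → suc n ≤ 2 * n
1+n≤2n {suc m} _ = s≤s (≤-trans (m≤m+n (suc m) m) (≤-reflexive (1+m+m≡m+[1+m+0] m)))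
  where
  1+m+m≡m+[1+m+0] : ∀ m → suc m + m ≡ m + (suc m + 0)
  1+m+m≡m+[1+m+0] = solve-∀

1+n≤2n∸1 : ∀ {n} → 2 ≤ n → suc n ≤ 2 * n ∸ 1
1+n≤2n∸1 {suc 0} (s≤s ())
1+n≤2n∸1 {suc (suc m)} _ = ≤-trans (m≤m+n (suc (suc (suc m))) m) (≤-reflexive (3+m+m≡[2+m+[2+m+0]]∸1 m))
  where
  3+m+m≡[2+m+[2+m+0]]∸1 : ∀ m → suc (suc (suc m)) + m ≡ suc m + suc (suc m + 0)
  3+m+m≡[2+m+[2+m+0]]∸1 = solve-∀

2n∸1+x≡1+2n⇒x≡2 : ∀ {n x} → 1 ≤ n → (2 * n ∸ 1) + x ≡ suc (2 * n) → x ≡ 2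
2n∸1+x≡1+2n⇒x≡2 {suc m} {x} _ eq = +-cancelˡ-≡ (m + suc (m + 0)) x 2 (trans eq (sym (m+[1+m+0]+2≡1+2[1+m] m)))
  where
  m+[1+m+0]+2≡1+2[1+m] : ∀ m → m + suc (m + 0) + 2 ≡ suc (2 * suc m)
  m+[1+m+0]+2≡1+2[1+m] = solve-∀

module InternalPartition {k : ℕ} (F : FiniteField (2 * k)) (2≤k : 2 ≤ k) where
  open PG2 F
  open Plane F
  open Equivalence using (to; from)

  0<k : 0 < k
  0<k = ≤-trans (s≤s z≤n) 2≤k

  module _
    (M : Point → Bool)
    (|M| : HasSize (Σ Point (λ p → M p ≡ true)) (k * (2 * k ∸ 1)))
    (M-lines : ∀ L → HasSize (Σ Point (λ p → Incident p L × M p ≡ true)) 0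
                   ⊎ HasSize (Σ Point (λ p → Incident p L × M p ≡ true)) k)
    (ℓ : Line)
    (|ℓ∩M| : HasSize (Σ Point (λ p → Incident p ℓ × M p ≡ true)) k)
    (inA : Vertex → Bool)
    (inA-point : ∀ p → (inA (inj₁ p) ≡ true) ⇔ ((M p ≡ true × ¬ Incident p ℓ) ⊎ (M p ≡ false × Incident p ℓ)))
    (inA-line : ∀ L → (inA (inj₂ L) ≡ true) ⇔
      (Σ Point (λ p → Incident p ℓ × M p ≡ false × Incident p L) × Σ Point (λ p → Incident p L × M p ≡ true)))
    where

    M-on-line : ∀ {L n} → HasSize (Σ Point (λ p → Incident p L × M p ≡ true)) n → count (λ r → inc r L ∧ M r) ≡ n
    M-on-line {L} = count-reflects (λ r → ×-irrelevant (Incident-irrelevant {r} {L}) Bool-≡-irrelevant)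
                                   (λ _ → ×⇔∧ Incident⇔inc (mk⇔ id id))

    0-or-k : ∀ L → count (λ r → inc r L ∧ M r) ≡ 0 ⊎ count (λ r → inc r L ∧ M r) ≡ k
    0-or-k L = Sum.map M-on-line M-on-line (M-lines L)

    open MaximalArc 0<k M 0-or-k

    secant∖M-size : ∀ {L} → secant L ≡ true → count (λ r → inc r L ∧ not (M r)) ≡ suc k
    secant∖M-size {L} secant-L = n+x≡1+2n⇒x≡1+n k (begin
      k + count (λ r → inc r L ∧ not (M r))
        ≡⟨ cong (_+ count (λ r → inc r L ∧ not (M r))) (sym (secant-size secant-L)) ⟩
      count (λ r → inc r L ∧ M r) + count (λ r → inc r L ∧ not (M r))
        ≡⟨ sym (count-∧-split _ M) ⟩
      count (λ r → inc r L)
        ≡⟨ line-size L ⟩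
      suc (2 * k) ∎)
      where open ≡-Reasoning

    ℓ-secant : secant ℓ ≡ true
    ℓ-secant = to (does⇔ (1 ≤? _)) (subst (1 ≤_) (sym (M-on-line |ℓ∩M|)) 0<k)

    ℓ∖M-size : count (λ r → inc r ℓ ∧ not (M r)) ≡ suc k
    ℓ∖M-size = secant∖M-size ℓ-secant

    secant-pencil-size : ∀ {p} → M p ≡ false → count (λ L → inc p L ∧ secant L) ≡ 2 * k ∸ 1
    secant-pencil-size p∉M = *-cancelʳ-≡ _ _ k {{>-nonZero 0<k}}
      (trans (secants-through p∉M) (trans (count-unique |M|) (ℕₚ.*-comm k _)))

    external-pencil-size : ∀ {p} → M p ≡ false → count (λ L → inc p L ∧ not (secant L)) ≡ 2
    external-pencil-size {p} p∉M = 2n∸1+x≡1+2n⇒x≡2 (≤-trans (s≤s z≤n) 2≤k) (begin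
      (2 * k ∸ 1) + count (λ L → inc p L ∧ not (secant L))
        ≡⟨ cong (_+ count (λ L → inc p L ∧ not (secant L))) (sym (secant-pencil-size p∉M)) ⟩
      count (λ L → inc p L ∧ secant L) + count (λ L → inc p L ∧ not (secant L))
        ≡⟨ sym (count-∧-split _ secant) ⟩
      count (λ L → inc p L)
        ≡⟨ pencil-size p ⟩
      suc (2 * k) ∎)
      where open ≡-Reasoning

    ℓ∖M-point : Σ Point (λ r → inc r ℓ ≡ true × M r ≡ false)
    ℓ∖M-point = let r , e = count>0⇒Sat (subst (0 <_) (sym ℓ∖M-size) (s≤s z≤n))
                in r , ∧-elimˡ e , not-≡true (∧-elimʳ e)

    inA-point≡ : ∀ p → inA (inj₁ p) ≡ M p xor inc p ℓ
    inA-point≡ p = xor-intro (Sum.map (Prod.map₂ (to ¬Incident⇔inc)) (Prod.map₂ (to Incident⇔inc)) ∘ to (inA-point p))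
                                (from (inA-point p) ∘ Sum.map (Prod.map₂ (from ¬Incident⇔inc)) (Prod.map₂ (from Incident⇔inc)))

    line∈A-intro : ∀ {r L} → inc r ℓ ≡ true → M r ≡ false → inc r L ≡ true → secant L ≡ true → inA (inj₂ L) ≡ true
    line∈A-intro {r} r∈ℓ r∉M r∈L secant-L =
      let m , m∈L , m∈M = secant-point secant-L
      in from (inA-line _) ((r , from Incident⇔inc r∈ℓ , r∉M , from Incident⇔inc r∈L) , (m , from Incident⇔inc m∈L , m∈M))

    line∈A-elim : ∀ {L} → inA (inj₂ L) ≡ true →
      Σ Point (λ r → inc r ℓ ≡ true × M r ≡ false × inc r L ≡ true) × secant L ≡ true
    line∈A-elim {L} L∈A =
      let (r , r∈ℓ , r∉M , r∈L) , (m , m∈L , m∈M) = to (inA-line L) L∈A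
      in (r , to Incident⇔inc r∈ℓ , r∉M , to Incident⇔inc r∈L) , secant-intro (to Incident⇔inc m∈L) m∈M

    ℓ∈A : inA (inj₂ ℓ) ≡ true
    ℓ∈A = let _ , r∈ℓ , r∉M = ℓ∖M-point in line∈A-intro r∈ℓ r∉M r∈ℓ ℓ-secant

    inA-line≡ : ∀ {r N} → ¬ N ≡ ℓ → inc r N ≡ true → inc r ℓ ≡ true → inA (inj₂ N) ≡ not (M r) ∧ secant N
    inA-line≡ {r} {N} N≢ℓ r∈N r∈ℓ = ⇔⇒≡ (mk⇔ ⇒ ⇐)
      where
      ⇒ : inA (inj₂ N) ≡ true → not (M r) ∧ secant N ≡ true
      ⇒ N∈A =
        let (r′ , r′∈ℓ , r′∉M , r′∈N) , secant-N = line∈A-elim N∈A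
        in ∧-intro (cong not (trans (cong M (two-lines-one-point N≢ℓ r∈N r∈ℓ r′∈N r′∈ℓ)) r′∉M)) secant-N
      ⇐ : not (M r) ∧ secant N ≡ true → inA (inj₂ N) ≡ true
      ⇐ e = line∈A-intro r∈ℓ (not-≡true (∧-elimˡ e)) r∈N (∧-elimʳ e)

    point-in-M∖ℓ : ∀ {p} → M p ≡ true → inc p ℓ ≡ false → count (λ L → inc p L ∧ inA (inj₂ L)) ≡ suc k
    point-in-M∖ℓ {p} p∈M p∉ℓ = trans (sym (perspectivity p∉ℓ (not ∘ M) (inA ∘ inj₂) through-p)) ℓ∖M-size
      where
      through-p : ∀ {r N} → inc r ℓ ≡ true → inc p N ≡ true → inc r N ≡ true → inA (inj₂ N) ≡ not (M r)
      through-p {r} {N} r∈ℓ p∈N r∈N = begin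
        inA (inj₂ N)           ≡⟨ inA-line≡ (≢-by (inc p) p∈N p∉ℓ) r∈N r∈ℓ ⟩
        not (M r) ∧ secant N   ≡⟨ cong (not (M r) ∧_) (secant-intro p∈N p∈M) ⟩
        not (M r) ∧ true       ≡⟨ ∧-identityʳ _ ⟩
        not (M r)              ∎
        where open ≡-Reasoning

    point-in-ℓ∖M : ∀ {p} → M p ≡ false → inc p ℓ ≡ true → suc k ≤ count (λ L → inc p L ∧ inA (inj₂ L))
    point-in-ℓ∖M {p} p∉M p∈ℓ = begin
      suc k                                    ≤⟨ 1+n≤2n∸1 2≤k ⟩
      2 * k ∸ 1                                ≡⟨ sym (secant-pencil-size p∉M) ⟩
      count (λ L → inc p L ∧ secant L)         ≤⟨ count-mono secant⇒A ⟩
      count (λ L → inc p L ∧ inA (inj₂ L))     ∎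
      where
      open ≤-Reasoning
      secant⇒A : ∀ L → inc p L ∧ secant L ≡ true → inc p L ∧ inA (inj₂ L) ≡ true
      secant⇒A L e = ∧-intro (∧-elimˡ e) (line∈A-intro p∈ℓ p∉M (∧-elimˡ e) (∧-elimʳ e))

    point-in-M∩ℓ : ∀ {p} → M p ≡ true → inc p ℓ ≡ true → suc k ≤ count (λ L → inc p L ∧ not (inA (inj₂ L)))
    point-in-M∩ℓ {p} p∈M p∈ℓ = via ℓ∖M-point
      where
      via : Σ Point (λ r → inc r ℓ ≡ true × M r ≡ false) → suc k ≤ count (λ L → inc p L ∧ not (inA (inj₂ L)))
      via (r , r∈ℓ , r∉M) = begin
        suc k                                        ≤⟨ 1+n≤2n (≤-trans (s≤s z≤n) 2≤k) ⟩
        2 * k                                        ≡⟨ sym (pencil-minus-pencil (≢-by M p∈M r∉M)) ⟩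
        count (λ L → inc p L ∧ not (inc r L))        ≤⟨ count-mono avoiding-r⇒B ⟩
        count (λ L → inc p L ∧ not (inA (inj₂ L)))   ∎
        where
        open ≤-Reasoning
        L∉A : ∀ {L} → inc p L ≡ true → inc r L ≡ false → inA (inj₂ L) ≡ false
        L∉A {L} p∈L r∉L =
          trans (inA-line≡ (≢-by (inc r) r∈ℓ r∉L ∘ sym) p∈L p∈ℓ) (cong (λ m → not m ∧ secant L) p∈M)
        avoiding-r⇒B : ∀ L → inc p L ∧ not (inc r L) ≡ true → inc p L ∧ not (inA (inj₂ L)) ≡ true
        avoiding-r⇒B L e = ∧-intro (∧-elimˡ e) (cong not (L∉A (∧-elimˡ e) (not-≡true (∧-elimʳ e))))

    secants-in-B : ∀ {p} → inc p ℓ ≡ false → count (λ L → (inc p L ∧ not (inA (inj₂ L))) ∧ secant L) ≡ k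
    secants-in-B {p} p∉ℓ = trans (count-cong (λ L → ∧-assoc (inc p L) _ _))
      (trans (sym (perspectivity p∉ℓ M (λ N → not (inA (inj₂ N)) ∧ secant N) through-p)) (M-on-line |ℓ∩M|))
      where
      not[not-m∧s]∧s≡m : ∀ m s → (m ≡ true → s ≡ true) → not (not m ∧ s) ∧ s ≡ m
      not[not-m∧s]∧s≡m true  true  _   = refl
      not[not-m∧s]∧s≡m true  false m⇒s = m⇒s refl
      not[not-m∧s]∧s≡m false true  _   = refl
      not[not-m∧s]∧s≡m false false _   = refl
      through-p : ∀ {r N} → inc r ℓ ≡ true → inc p N ≡ true → inc r N ≡ true → not (inA (inj₂ N)) ∧ secant N ≡ M r
      through-p {r} {N} r∈ℓ p∈N r∈N =
        trans (cong (λ a → not a ∧ secant N) (inA-line≡ (≢-by (inc p) p∈N p∉ℓ) r∈N r∈ℓ))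
              (not[not-m∧s]∧s≡m (M r) (secant N) (secant-intro r∈N))

    point-off-M∪ℓ : ∀ {p} → M p ≡ false → inc p ℓ ≡ false → suc k ≤ count (λ L → inc p L ∧ not (inA (inj₂ L)))
    point-off-M∪ℓ {p} p∉M p∉ℓ = begin
      suc k                                                      ≤⟨ n≤1+n (suc k) ⟩
      2 + k                                                      ≡⟨ ℕₚ.+-comm 2 k ⟩
      k + 2                                                      ≡⟨ sym (cong₂ _+_ (secants-in-B p∉ℓ) externals-in-B) ⟩
      count (λ L → (inc p L ∧ not (inA (inj₂ L))) ∧ secant L)
        + count (λ L → (inc p L ∧ not (inA (inj₂ L))) ∧ not (secant L)) ≡⟨ sym (count-∧-split _ secant) ⟩
      count (λ L → inc p L ∧ not (inA (inj₂ L)))                 ∎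
      where
      open ≤-Reasoning
      [i∧not-a]∧not-s≡i∧not-s : ∀ i {a s} → (a ≡ true → s ≡ true) → (i ∧ not a) ∧ not s ≡ i ∧ not s
      [i∧not-a]∧not-s≡i∧not-s i {false} {s}     _   = cong (_∧ not s) (∧-identityʳ i)
      [i∧not-a]∧not-s≡i∧not-s i {true}  {true}  _   = trans (cong (_∧ false) (∧-zeroʳ i)) (sym (∧-zeroʳ i))
      [i∧not-a]∧not-s≡i∧not-s i {true}  {false} a⇒s = case a⇒s refl of λ ()
      externals-in-B : count (λ L → (inc p L ∧ not (inA (inj₂ L))) ∧ not (secant L)) ≡ 2
      externals-in-B = trans (count-cong (λ L → [i∧not-a]∧not-s≡i∧not-s (inc p L) (proj₂ ∘ line∈A-elim)))
                             (external-pencil-size p∉M)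

    ℓ-in-A : count (λ r → inc r ℓ ∧ (M r xor inc r ℓ)) ≡ suc k
    ℓ-in-A = trans (count-cong (λ r → i∧[m-xor-i]≡i∧not-m (inc r ℓ) (M r))) ℓ∖M-size
      where
      i∧[m-xor-i]≡i∧not-m : ∀ i m → i ∧ (m xor i) ≡ i ∧ not m
      i∧[m-xor-i]≡i∧not-m false _     = refl
      i∧[m-xor-i]≡i∧not-m true  true  = refl
      i∧[m-xor-i]≡i∧not-m true  false = refl

    line-in-A-crossing-ℓ : ∀ {L r₀} → inA (inj₂ L) ≡ true → ¬ L ≡ ℓ → inc r₀ L ≡ true → inc r₀ ℓ ≡ true →
                           suc k ≤ count (λ r → inc r L ∧ (M r xor inc r ℓ))
    line-in-A-crossing-ℓ {L} {r₀} L∈A L≢ℓ r₀∈L r₀∈ℓ = begin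
      suc k                                                       ≡⟨ ℕₚ.+-comm 1 k ⟩
      k + 1                                                       ≤⟨ +-mono-≤ on-M (Sat⇒0<count (r₀ , r₀-in-A)) ⟩
      count (λ r → (inc r L ∧ (M r xor inc r ℓ)) ∧ M r)
        + count (λ r → (inc r L ∧ (M r xor inc r ℓ)) ∧ not (M r)) ≡⟨ sym (count-∧-split _ M) ⟩
      count (λ r → inc r L ∧ (M r xor inc r ℓ))                   ∎
      where
      open ≤-Reasoning
      r₀∉M∧secant : not (M r₀) ∧ secant L ≡ true
      r₀∉M∧secant = trans (sym (inA-line≡ L≢ℓ r₀∈L r₀∈ℓ)) L∈A
      r₀∉M : M r₀ ≡ false
      r₀∉M = not-≡true (∧-elimˡ r₀∉M∧secant)
      r₀-in-A : (inc r₀ L ∧ (M r₀ xor inc r₀ ℓ)) ∧ not (M r₀) ≡ true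
      r₀-in-A = shape (inc r₀ L) (M r₀) (inc r₀ ℓ) r₀∈L r₀∉M r₀∈ℓ
        where
        shape : ∀ i m j → i ≡ true → m ≡ false → j ≡ true → (i ∧ (m xor j)) ∧ not m ≡ true
        shape _ _ _ refl refl refl = refl
      L∩M-in-A : ∀ r → inc r L ∧ M r ≡ true → (inc r L ∧ (M r xor inc r ℓ)) ∧ M r ≡ true
      L∩M-in-A r e = shape (inc r L) (M r) (inc r ℓ) (∧-elimˡ e) (∧-elimʳ e) r∉ℓ
        where
        r∉ℓ : inc r ℓ ≡ false
        r∉ℓ = ¬-not (λ r∈ℓ → ≢-by M (∧-elimʳ e) r₀∉M (two-lines-one-point L≢ℓ (∧-elimˡ e) r∈ℓ r₀∈L r₀∈ℓ))
        shape : ∀ i m j → i ≡ true → m ≡ true → j ≡ false → (i ∧ (m xor j)) ∧ m ≡ true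
        shape _ _ _ refl refl refl = refl
      on-M : k ≤ count (λ r → (inc r L ∧ (M r xor inc r ℓ)) ∧ M r)
      on-M = begin
        k                                                  ≡⟨ sym (secant-size (∧-elimʳ r₀∉M∧secant)) ⟩
        count (λ r → inc r L ∧ M r)                        ≤⟨ count-mono L∩M-in-A ⟩
        count (λ r → (inc r L ∧ (M r xor inc r ℓ)) ∧ M r)  ∎

    line-in-A : ∀ {L} → inA (inj₂ L) ≡ true → suc k ≤ count (λ r → inc r L ∧ (M r xor inc r ℓ))
    line-in-A {L} L∈A = by-cases (L ≟ₚ ℓ)
      where
      by-cases : Dec (L ≡ ℓ) → suc k ≤ count (λ r → inc r L ∧ (M r xor inc r ℓ))
      by-cases (yes refl) = ≤-reflexive (sym ℓ-in-A)
      by-cases (no L≢ℓ)   =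
        let r₀∈L , r₀∈ℓ = meet-incident L ℓ L≢ℓ in line-in-A-crossing-ℓ L∈A L≢ℓ r₀∈L r₀∈ℓ

    outside-M∪ℓ : ∀ i m j → i ≡ true → m ≡ false → j ≡ false → i ∧ not (m xor j) ≡ true
    outside-M∪ℓ _ _ _ refl refl refl = refl

    secant-in-B : ∀ {L r₀} → inA (inj₂ L) ≡ false → ¬ L ≡ ℓ → inc r₀ L ≡ true → inc r₀ ℓ ≡ true →
                  secant L ≡ true → suc k ≤ count (λ r → inc r L ∧ not (M r xor inc r ℓ))
    secant-in-B {L} {r₀} L∉A L≢ℓ r₀∈L r₀∈ℓ secant-L = begin
      suc k                                          ≡⟨ sym (secant∖M-size secant-L) ⟩
      count (λ r → inc r L ∧ not (M r))              ≤⟨ count-mono L∖M-in-B ⟩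
      count (λ r → inc r L ∧ not (M r xor inc r ℓ))  ∎
      where
      open ≤-Reasoning
      r₀∈M : M r₀ ≡ true
      r₀∈M = not-≡false (trans (sym (∧-identityʳ _))
        (trans (cong (not (M r₀) ∧_) (sym secant-L)) (trans (sym (inA-line≡ L≢ℓ r₀∈L r₀∈ℓ)) L∉A)))
      L∖M-in-B : ∀ r → inc r L ∧ not (M r) ≡ true → inc r L ∧ not (M r xor inc r ℓ) ≡ true
      L∖M-in-B r e = outside-M∪ℓ (inc r L) (M r) (inc r ℓ) (∧-elimˡ e) r∉M
        (¬-not (λ r∈ℓ → ≢-by M r₀∈M r∉M (two-lines-one-point L≢ℓ r₀∈L r₀∈ℓ (∧-elimˡ e) r∈ℓ)))
        where
        r∉M : M r ≡ false
        r∉M = not-≡true (∧-elimʳ e)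

    external-in-B : ∀ {L} → ¬ L ≡ ℓ → secant L ≡ false → suc k ≤ count (λ r → inc r L ∧ not (M r xor inc r ℓ))
    external-in-B {L} L≢ℓ external-L = begin
      suc k                                          ≤⟨ 1+n≤2n (≤-trans (s≤s z≤n) 2≤k) ⟩
      2 * k                                          ≡⟨ sym (line-minus-line L≢ℓ) ⟩
      count (λ r → inc r L ∧ not (inc r ℓ))          ≤⟨ count-mono L∖ℓ-in-B ⟩
      count (λ r → inc r L ∧ not (M r xor inc r ℓ))  ∎
      where
      open ≤-Reasoning
      L∖ℓ-in-B : ∀ r → inc r L ∧ not (inc r ℓ) ≡ true → inc r L ∧ not (M r xor inc r ℓ) ≡ true
      L∖ℓ-in-B r e = outside-M∪ℓ (inc r L) (M r) (inc r ℓ) (∧-elimˡ e)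
        (¬-not (λ r∈M → ≢-by secant (secant-intro (∧-elimˡ e) r∈M) external-L refl)) (not-≡true (∧-elimʳ e))

    line-in-B : ∀ {L} → inA (inj₂ L) ≡ false → suc k ≤ count (λ r → inc r L ∧ not (M r xor inc r ℓ))
    line-in-B {L} L∉A = by-secant (secant L) refl
      where
      L≢ℓ : ¬ L ≡ ℓ
      L≢ℓ = ≢-by (inA ∘ inj₂) ℓ∈A L∉A ∘ sym
      by-secant : ∀ s → secant L ≡ s → suc k ≤ count (λ r → inc r L ∧ not (M r xor inc r ℓ))
      by-secant true  secant-L   =
        let r₀∈L , r₀∈ℓ = meet-incident L ℓ L≢ℓ in secant-in-B L∉A L≢ℓ r₀∈L r₀∈ℓ secant-L
      by-secant false external-L = external-in-B L≢ℓ external-L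

    point-half-degree : ∀ p → suc k ≤ count (λ L → inc p L ∧ (inA (inj₂ L) == inA (inj₁ p)))
    point-half-degree p = subst (λ a → suc k ≤ count (λ L → inc p L ∧ (inA (inj₂ L) == a))) (sym (inA-point≡ p))
      (by-cases (M p) (inc p ℓ) refl refl)
      where
      by-cases : ∀ m i → M p ≡ m → inc p ℓ ≡ i → suc k ≤ count (λ L → inc p L ∧ (inA (inj₂ L) == (m xor i)))
      by-cases true  false p∈M p∉ℓ = ≤-reflexive (sym (point-in-M∖ℓ p∈M p∉ℓ))
      by-cases false true  p∉M p∈ℓ = point-in-ℓ∖M p∉M p∈ℓ
      by-cases true  true  p∈M p∈ℓ = point-in-M∩ℓ p∈M p∈ℓ
      by-cases false false p∉M p∉ℓ = point-off-M∪ℓ p∉M p∉ℓ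

    line-half-degree : ∀ L → suc k ≤ count (λ r → inc r L ∧ (inA (inj₁ r) == inA (inj₂ L)))
    line-half-degree L = by-cases (inA (inj₂ L)) refl
      where
      by-cases : ∀ a → inA (inj₂ L) ≡ a → suc k ≤ count (λ r → inc r L ∧ (inA (inj₁ r) == a))
      by-cases true  L∈A =
        subst (suc k ≤_) (count-cong (λ r → cong (inc r L ∧_) (sym (inA-point≡ r)))) (line-in-A L∈A)
      by-cases false L∉A =
        subst (suc k ≤_) (count-cong (λ r → cong (λ x → inc r L ∧ not x) (sym (inA-point≡ r)))) (line-in-B L∉A)

    point-degree : ∀ {p d} → HasSize (Σ Vertex (λ w → Adj (inj₁ p) w)) d → count (λ L → inc p L) ≡ d
    point-degree {p} |N| = count-reflects (λ L → Incident-irrelevant {p} {L}) (λ _ → Incident⇔inc)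
      (↔-trans (↔-sym (Σ-⊎-inj₂ (λ { _ () }))) |N|)

    line-degree : ∀ {L d} → HasSize (Σ Vertex (λ w → Adj (inj₂ L) w)) d → count (λ r → inc r L) ≡ d
    line-degree {L} |N| = count-reflects (λ r → Incident-irrelevant {r} {L}) (λ _ → Incident⇔inc)
      (↔-trans (↔-sym (Σ-⊎-inj₁ (λ { _ () }))) |N|)

    point-degree-in : ∀ {p b d} → HasSize (Σ Vertex (λ w → Adj (inj₁ p) w × inA w ≡ b)) d →
                      count (λ L → inc p L ∧ (inA (inj₂ L) == b)) ≡ d
    point-degree-in {p} |N| = count-reflects (λ L → ×-irrelevant (Incident-irrelevant {p} {L}) Bool-≡-irrelevant)
      (λ _ → ×⇔∧ Incident⇔inc (≡⇔== _ _)) (↔-trans (↔-sym (Σ-⊎-inj₂ (λ { _ (() , _) }))) |N|)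

    line-degree-in : ∀ {L b d} → HasSize (Σ Vertex (λ w → Adj (inj₂ L) w × inA w ≡ b)) d →
                     count (λ r → inc r L ∧ (inA (inj₁ r) == b)) ≡ d
    line-degree-in {L} |N| = count-reflects (λ r → ×-irrelevant (Incident-irrelevant {r} {L}) Bool-≡-irrelevant)
      (λ _ → ×⇔∧ Incident⇔inc (≡⇔== _ _)) (↔-trans (↔-sym (Σ-⊎-inj₁ (λ { _ (() , _) }))) |N|)

    internal : ∀ v b → inA v ≡ b → ∀ d d′ → HasSize (Σ Vertex (λ w → Adj v w)) d →
               HasSize (Σ Vertex (λ w → Adj v w × inA w ≡ b)) d′ → d ≤ 2 * d′
    internal (inj₁ p) _ refl d d′ |N| |N′| = subst₂ (λ d d′ → d ≤ 2 * d′)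
      (trans (sym (pencil-size p)) (point-degree |N|)) (point-degree-in |N′|) (1+n≤x⇒1+2n≤2x (point-half-degree p))
    internal (inj₂ L) _ refl d d′ |N| |N′| = subst₂ (λ d d′ → d ≤ 2 * d′)
      (trans (sym (line-size L)) (line-degree |N|)) (line-degree-in |N′|) (1+n≤x⇒1+2n≤2x (line-half-degree L))

    isInternalPartition : IsInternalPartition Vertex Adj inA
    isInternalPartition = record
      { A-nonempty = let r , r∈ℓ , r∉M = ℓ∖M-point in inj₁ r , trans (inA-point≡ r) (cong₂ _xor_ r∉M r∈ℓ)
      ; B-nonempty = let m , m∈ℓ , m∈M = secant-point ℓ-secant in inj₁ m , trans (inA-point≡ m) (cong₂ _xor_ m∈M m∈ℓ)
      ; A-internal = λ v → internal v true
      ; B-internal = λ v → internal v false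
      }

proposition3 : (h : ℕ) → 2 ≤ h → (F : FiniteField (2 ^ h)) →
    let open PG2 F in
    (M : Point → Bool) →
    HasSize (Σ Point (λ p → M p ≡ true)) (2 ^ (h ∸ 1) * (2 ^ h ∸ 1)) →
    (∀ L → HasSize (Σ Point (λ p → Incident p L × M p ≡ true)) 0
         ⊎ HasSize (Σ Point (λ p → Incident p L × M p ≡ true)) (2 ^ (h ∸ 1))) →
    (ℓ : Line) →
    HasSize (Σ Point (λ p → Incident p ℓ × M p ≡ true)) (2 ^ (h ∸ 1)) →
    (inA : Vertex → Bool) →
    (∀ p → (inA (inj₁ p) ≡ true) ⇔
      ((M p ≡ true × ¬ Incident p ℓ) ⊎ (M p ≡ false × Incident p ℓ))) →
    (∀ L → (inA (inj₂ L) ≡ true) ⇔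
      (Σ Point (λ p → Incident p ℓ × M p ≡ false × Incident p L)
       × Σ Point (λ p → Incident p L × M p ≡ true))) →
    IsInternalPartition Vertex Adj inA
proposition3 0             ()
proposition3 1             (s≤s ())
-- For h = 2 + h′, the sizes 2 ^ (h ∸ 1) and 2 ^ h are definitionally k and 2 * k with k = 2 ^ (1 + h′).
proposition3 (suc (suc h)) _        F = InternalPartition.isInternalPartition F (*-monoʳ-≤ 2 (m^n>0 2 h))
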